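{- Let $G$ and $H$ be finite simple graphs. If $\chi(H)\le\Delta(G)$, then $\Gamma(G\,\square\, H)\ge\Gamma(H)+1$.
   Context: $\chi$ is the chromatic number and $\Delta$ the maximum degree. The Cartesian product $G\,\square\, H$ has vertex set $V(G)\times V(H)$, and $(a,x)(b,y)$ is an edge iff either $a=b$ and $xy\in E(H)$, or $ab\in E(G)$ and $x=y$. A greedy $k$-colouring of a graph is a partition of its vertex set into $k$ nonempty stable sets $S_1,\dots,S_k$ such that for every $j<i$, every vertex of $S_i$ has a neighbour in $S_j$. The Grundy number $\Gamma$ is the largest such $k$. -}

module Defs where

open import Data.Nat using (ℕ; zero; suc; _≤_; _<_; _⊔_; _*_)
open import Data.Bool using (Bool; true; false; if_then_else_; _∨_; _∧_)
open import Data.Fin using (Fin; toℕ; combine; remQuot; _≟_)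
open import Data.List using (List; map; foldr; allFin)
open import Data.Nat.ListAction using (sum)
open import Data.Product using (Σ; _×_; _,_; ∃-syntax)
open import Relation.Binary.PropositionalEquality using (_≡_; _≢_; refl; sym)
open import Relation.Nullary using (yes; no)
open import Data.Empty using (⊥-elim)
import Data.Bool.Properties
open import Relation.Nullary.Decidable using (⌊_⌋)

record Graph (n : ℕ) : Set where
  field
    adj     : Fin n → Fin n → Bool
    symm    : ∀ u v → adj u v ≡ adj v u
    irrefl  : ∀ u → adj u u ≡ false
open Graph public

Adj : ∀ {n} → Graph n → Fin n → Fin n → Set
Adj G u v = adj G u v ≡ true

-- degree and maximum degree Δ (Δ of the graph with no vertices is 0)
degree : ∀ {n} → Graph n → Fin n → ℕ
degree {n} G u = sum (map (λ v → if adj G u v then 1 else 0) (allFin n))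

Δ : ∀ {n} → Graph n → ℕ
Δ {n} G = foldr _⊔_ 0 (map (degree G) (allFin n))

ProperColouring : ∀ {n} → Graph n → (k : ℕ) → (Fin n → Fin k) → Set
ProperColouring G k c = ∀ u v → Adj G u v → c u ≢ c v

Colourable : ∀ {n} → Graph n → ℕ → Set
Colourable G k = Σ _ λ c → ProperColouring G k c

IsChromaticNumber : ∀ {n} → Graph n → ℕ → Set
IsChromaticNumber G k = Colourable G k × (∀ m → Colourable G m → k ≤ m)

IsGreedyColouring : ∀ {n} → Graph n → (k : ℕ) → (Fin n → Fin k) → Set
IsGreedyColouring {n} G k c =
  (∀ (i : Fin k) → ∃[ v ] c v ≡ i)
  × ProperColouring G k c
  × (∀ v (j : Fin k) → toℕ j < toℕ (c v) → ∃[ u ] (Adj G v u × c u ≡ j))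

HasGreedyColouring : ∀ {n} → Graph n → ℕ → Set
HasGreedyColouring G k = Σ _ λ c → IsGreedyColouring G k c

IsGrundyNumber : ∀ {n} → Graph n → ℕ → Set
IsGrundyNumber G k = HasGreedyColouring G k × (∀ m → HasGreedyColouring G m → m ≤ k)

-- Cartesian product G □ H on Fin (m * n); the vertex (a , x) is
-- combine a x, and remQuot decodes a vertex back into the pair (a , x)
□-pairAdj : ∀ {m n} → Graph m → Graph n → Fin m × Fin n → Fin m × Fin n → Bool
□-pairAdj G H (a , x) (b , y) =
  (⌊ a ≟ b ⌋ ∧ adj H x y) ∨ (adj G a b ∧ ⌊ x ≟ y ⌋)

private
  ≟-sym : ∀ {k} (a b : Fin k) → ⌊ a ≟ b ⌋ ≡ ⌊ b ≟ a ⌋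
  ≟-sym a b with a ≟ b | b ≟ a
  ... | yes _ | yes _ = refl
  ... | no _ | no _ = refl
  ... | yes p | no q = ⊥-elim (q (sym p))
  ... | no p | yes q = ⊥-elim (p (sym q))

  ≟-refl : ∀ {k} (a : Fin k) → ⌊ a ≟ a ⌋ ≡ true
  ≟-refl a with a ≟ a
  ... | yes _ = refl
  ... | no p = ⊥-elim (p refl)

  pair-symm : ∀ {m n} (G : Graph m) (H : Graph n) p q →
              □-pairAdj G H p q ≡ □-pairAdj G H q p
  pair-symm G H (a , x) (b , y)
    rewrite ≟-sym a b | ≟-sym x y | symm G a b | symm H x y = refl

  pair-irrefl : ∀ {m n} (G : Graph m) (H : Graph n) p →
                □-pairAdj G H p p ≡ false
  pair-irrefl G H (a , x) rewrite irrefl G a | irrefl H x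
    | Data.Bool.Properties.∧-zeroʳ ⌊ a ≟ a ⌋ = refl

_□_ : ∀ {m n} → Graph m → Graph n → Graph (m * n)
_□_ {m} {n} G H = record
  { adj    = λ p q → □-pairAdj G H (remQuot {m} n p) (remQuot {m} n q)
  ; symm   = λ p q → pair-symm G H (remQuot {m} n p) (remQuot {m} n q)
  ; irrefl = λ p → pair-irrefl G H (remQuot {m} n p)
  }

-- Take a vertex u of maximum degree in G, a proper colouring ψ of H by
-- Δ(G) ≥ χ(H) distinct neighbours of u, and a greedy colouring c of H with
-- Γ(H) colours, numbered from 0. In G □ H colour the copy of H at u by 1 + c
-- and the vertex (ψ x , x) of the copy of H at ψ x by 0. This partial
-- colouring is already greedy on the coloured vertices: (u , x) sees colour 0
-- at (ψ x , x) and colour 1 + j at (u , y) for every j < c x. Any such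
-- partial greedy colouring extends to a greedy colouring of the whole graph,
-- by giving the remaining vertices large distinct colours and then
-- repeatedly lowering an uncoloured vertex to a colour missing from its
-- neighbourhood; the sum of the colours decreases. The vertex (u , x) with
-- c x = Γ(H) − 1 then has colour Γ(H), so at least Γ(H) + 1 colours are used.
module Submission where

open import Defs
open import Data.Nat using (ℕ; suc; _≤_; _+_)
open import Data.Nat as ℕ using (zero; _<_; z≤n; s≤s; s≤s⁻¹)
open import Data.Nat.Properties
  using (≤-trans; ≤-reflexive; <⇒≤; <⇒≱; ≤∧≢⇒<; <-≤-trans; m≤m+n; m≤n+m;
         +-mono-≤; +-mono-<-≤; +-mono-≤-<; +-cancelˡ-≡; +-comm; ⊔-sel;
         suc-injective; anyUpTo?; +-0-monoid; module ≤-Reasoning)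
open import Data.Nat.Induction using (<-wellFounded)
open import Data.Nat.ListAction using (sum)
open import Algebra.Properties.Monoid.Sum +-0-monoid using () renaming (sum to ∑)
open import Data.Fin as Fin
  using (Fin; toℕ; fromℕ; fromℕ<; combine; remQuot; lift; _≟_)
open import Data.Fin.Properties
  using (toℕ-injective; toℕ-fromℕ<; toℕ-fromℕ; toℕ<n; remQuot-combine; any?;
         lift-injective)
import Data.Fin.Properties as Fin
open import Data.Vec.Functional using (updateAt)
open import Data.Vec.Functional.Properties using (updateAt-updates; updateAt-minimal)
open import Data.Bool using (Bool; true; false; if_then_else_)
open import Data.Bool.Properties using (T-≡; T-∧; T-∨; ∨-zeroʳ)
open import Data.Maybe using (Maybe; just; nothing; fromMaybe)
open import Data.Maybe.Properties using (just-injective)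
open import Data.List using (map; tabulate; allFin)
open import Data.List.Membership.Propositional.Properties
  using (foldr-selective; ∈-map⁻; ∈-allFin)
import Data.List.Relation.Unary.All as All
open import Data.List.Extrema.Nat using (argmax; f[xs]≤f[argmax])
open import Data.Product using (Σ; _×_; _,_; proj₂; ∃-syntax)
open import Data.Sum using (_⊎_; inj₁; inj₂)
open import Data.Empty using (⊥-elim)
open import Function using (_∘_; const; id; _on_; Injective; Equivalence)
open import Induction.WellFounded using (Acc; acc)
import Relation.Binary.Construct.On as On
open import Relation.Nullary using (Dec; yes; no; ¬_; ¬?)
open import Relation.Nullary.Decidable using (toWitness; dec-yes; decidable-stable; _×-dec_)
open import Relation.Binary.PropositionalEquality

open Equivalence using (to; from)

private
  variable
    k m n N : ℕ

∑-mono-≤ : ∀ {f g : Fin N → ℕ} → (∀ i → f i ≤ g i) → ∑ f ≤ ∑ g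
∑-mono-≤ {zero}  f≤g = z≤n
∑-mono-≤ {suc N} f≤g = +-mono-≤ (f≤g Fin.zero) (∑-mono-≤ (f≤g ∘ Fin.suc))

∑-mono-< : ∀ {f g : Fin N → ℕ} → (∀ i → f i ≤ g i) → ∀ v → f v < g v → ∑ f < ∑ g
∑-mono-< f≤g Fin.zero    lt = +-mono-<-≤ lt (∑-mono-≤ (f≤g ∘ Fin.suc))
∑-mono-< f≤g (Fin.suc v) lt = +-mono-≤-< (f≤g Fin.zero) (∑-mono-< (f≤g ∘ Fin.suc) v lt)

term≤∑ : ∀ (f : Fin N → ℕ) v → f v ≤ ∑ f
term≤∑ f Fin.zero    = m≤m+n _ _
term≤∑ f (Fin.suc v) = ≤-trans (term≤∑ (f ∘ Fin.suc) v) (m≤n+m _ (f Fin.zero))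

sum-map-tabulate : ∀ {A : Set} (h : A → ℕ) (g : Fin N → A) →
                   sum (map h (tabulate g)) ≡ ∑ (h ∘ g)
sum-map-tabulate {zero}  h g = refl
sum-map-tabulate {suc N} h g = cong (h (g Fin.zero) +_) (sum-map-tabulate h (g ∘ Fin.suc))

trues-injection : ∀ {d} (f : Fin N → Bool) → d ≤ ∑ (λ v → if f v then 1 else 0) →
                  Σ (Fin d → Fin N) λ g → Injective _≡_ _≡_ g × (∀ i → f (g i) ≡ true)
trues-injection {d = zero} f _ = (λ ()) , (λ { {()} }) , λ ()
trues-injection {suc N} {suc d} f d≤∑ with f Fin.zero in f0
... | true with trues-injection (f ∘ Fin.suc) (s≤s⁻¹ d≤∑)
...   | g , g-inj , g-true = lift 1 g , lift-injective g g-inj 1 , true-at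
  where
  true-at : ∀ i → f (lift 1 g i) ≡ true
  true-at Fin.zero    = f0
  true-at (Fin.suc i) = g-true i
trues-injection {suc N} {suc d} f d≤∑ | false with trues-injection (f ∘ Fin.suc) d≤∑
...   | g , g-inj , g-true = Fin.suc ∘ g , g-inj ∘ Fin.suc-injective , g-true

¬Adj-refl : ∀ (X : Graph N) {v} → ¬ Adj X v v
¬Adj-refl X {v} e with () ← trans (sym e) (irrefl X v)

Δ-attained : ∀ (G : Graph (suc m)) → ∃[ u ] Δ G ≤ degree G u
Δ-attained G with foldr-selective ⊔-sel 0 (map (degree G) (allFin _))
... | inj₁ Δ≡0 = Fin.zero , ≤-trans (≤-reflexive Δ≡0) z≤n
... | inj₂ Δ∈ with ∈-map⁻ (degree G) Δ∈
...   | u , _ , Δ≡deg = u , ≤-reflexive Δ≡deg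

neighbourhood-injection : ∀ (G : Graph N) u {d} → d ≤ degree G u →
                          Σ (Fin d → Fin N) λ b → Injective _≡_ _≡_ b × (∀ i → Adj G u (b i))
neighbourhood-injection G u d≤deg =
  trues-injection (adj G u) (subst (_ ≤_) (sum-map-tabulate (λ v → if adj G u v then 1 else 0) id) d≤deg)

IsProper : Graph N → (Fin N → ℕ) → Set
IsProper X c = ∀ v w → Adj X v w → c v ≢ c w

IsGreedy : Graph N → (Fin N → ℕ) → Set
IsGreedy X c = ∀ v j → j < c v → ∃[ w ] Adj X v w × c w ≡ j

toℕ-proper : ∀ (X : Graph N) {c : Fin N → Fin k} → ProperColouring X k c → IsProper X (toℕ ∘ c)
toℕ-proper X proper v w e = proper v w e ∘ toℕ-injective

toℕ-greedy : ∀ (X : Graph N) {c : Fin N → Fin k} → IsGreedyColouring X k c → IsGreedy X (toℕ ∘ c)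
toℕ-greedy X {c} (_ , _ , greedy) v j j<cv =
  let j′ = fromℕ< (<-≤-trans j<cv (<⇒≤ (toℕ<n (c v))))
      w , e , cw≡j′ = greedy v j′ (subst (_< toℕ (c v)) (sym (toℕ-fromℕ< _)) j<cv)
  in w , e , trans (cong toℕ cw≡j′) (toℕ-fromℕ< _)

greedy-colouring-above : ∀ (X : Graph N) {c : Fin N → ℕ} → IsProper X c → IsGreedy X c →
                         ∀ v → ∃[ M ] c v < M × HasGreedyColouring X M
greedy-colouring-above {N} X {c} proper greedy v =
  suc (c top) , s≤s (c≤top v) , colour , onto , proper′ , greedy′
  where
  top : Fin N
  top = argmax c v (allFin N)

  c≤top : ∀ w → c w ≤ c top
  c≤top w = All.lookup (f[xs]≤f[argmax] {f = c} v (allFin N)) (∈-allFin w)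

  colour : Fin N → Fin (suc (c top))
  colour w = fromℕ< (s≤s (c≤top w))

  toℕ-colour : ∀ w → toℕ (colour w) ≡ c w
  toℕ-colour w = toℕ-fromℕ< _

  onto : ∀ i → ∃[ w ] colour w ≡ i
  onto i with toℕ i ℕ.≟ c top
  ... | yes i≡top = top , toℕ-injective (trans (toℕ-colour top) (sym i≡top))
  ... | no  i≢top with greedy top (toℕ i) (≤∧≢⇒< (s≤s⁻¹ (toℕ<n i)) i≢top)
  ...   | w , _ , cw≡i = w , toℕ-injective (trans (toℕ-colour w) cw≡i)

  proper′ : ProperColouring X (suc (c top)) colour
  proper′ v w e eq = proper v w e (trans (sym (toℕ-colour v)) (trans (cong toℕ eq) (toℕ-colour w)))

  greedy′ : ∀ v j → toℕ j < toℕ (colour v) → ∃[ w ] Adj X v w × colour w ≡ j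
  greedy′ v j j<v with greedy v (toℕ j) (subst (toℕ j <_) (toℕ-colour v) j<v)
  ... | w , e , cw≡j = w , e , toℕ-injective (trans (toℕ-colour w) cw≡j)

record IsPartialGreedy {A : Set} (E : A → A → Set) (κ : A → Maybe ℕ) : Set where
  field
    proper : ∀ {v w i} → E v w → κ v ≡ just i → κ w ≢ just i
    greedy : ∀ {v i j} → κ v ≡ just i → j < i → ∃[ w ] E v w × κ w ≡ just j

module Extension (X : Graph N) {κ : Fin N → Maybe ℕ} (κ-greedy : IsPartialGreedy (Adj X) κ) where
  open IsPartialGreedy κ-greedy

  Extends : (Fin N → ℕ) → Set
  Extends c = ∀ {v i} → κ v ≡ just i → c v ≡ i

  SeesColour : (Fin N → ℕ) → Fin N → ℕ → Set
  SeesColour c v j = ∃[ w ] Adj X v w × c w ≡ j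

  Defect : (Fin N → ℕ) → Set
  Defect c = ∃[ v ] ∃[ j ] j < c v × ¬ SeesColour c v j

  sees? : ∀ c v j → Dec (SeesColour c v j)
  sees? c v j = any? λ w → (adj X v w Data.Bool.≟ true) ×-dec (c w ℕ.≟ j)

  defect? : ∀ c → Dec (Defect c)
  defect? c = any? λ v → anyUpTo? (λ j → ¬? (sees? c v j)) (c v)

  defect-free⇒greedy : ∀ {c} → ¬ Defect c → IsGreedy X c
  defect-free⇒greedy {c} none v j j<cv =
    decidable-stable (sees? c v j) λ blind → none (v , j , j<cv , blind)

  defect-uncoloured : ∀ {c v j i} → Extends c → j < c v → ¬ SeesColour c v j → κ v ≢ just i
  defect-uncoloured ext j<cv blind κv with greedy κv (subst (_ <_) (ext κv) j<cv)
  ... | w , e , κw = blind (w , e , ext κw)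

  recolour : (Fin N → ℕ) → Fin N → ℕ → Fin N → ℕ
  recolour c v j = updateAt c v (const j)

  recolour-proper : ∀ {c v j} → IsProper X c → ¬ SeesColour c v j → IsProper X (recolour c v j)
  recolour-proper {c} {v} {j} proper blind w₁ w₂ e eq with w₁ ≟ v | w₂ ≟ v
  ... | yes refl | yes refl = ¬Adj-refl X e
  ... | yes refl | no w₂≢v  =
    blind (w₂ , e , trans (sym (updateAt-minimal w₂ v c w₂≢v)) (trans (sym eq) (updateAt-updates v c)))
  ... | no w₁≢v  | yes refl =
    blind (w₁ , trans (symm X v w₁) e , trans (sym (updateAt-minimal w₁ v c w₁≢v)) (trans eq (updateAt-updates v c)))
  ... | no w₁≢v  | no w₂≢v  =
    proper w₁ w₂ e (trans (sym (updateAt-minimal w₁ v c w₁≢v)) (trans eq (updateAt-minimal w₂ v c w₂≢v)))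

  recolour-extends : ∀ {c v j} → Extends c → (∀ {i} → κ v ≢ just i) → Extends (recolour c v j)
  recolour-extends {c} {v} ext uncoloured {w} κw with w ≟ v
  ... | yes refl = ⊥-elim (uncoloured κw)
  ... | no w≢v   = trans (updateAt-minimal w v c w≢v) (ext κw)

  recolour-decreases : ∀ {c v j} → j < c v → ∑ (recolour c v j) < ∑ c
  recolour-decreases {c} {v} {j} j<cv =
    ∑-mono-< recolour≤ v (subst (_< c v) (sym (updateAt-updates v c)) j<cv)
    where
    recolour≤ : ∀ w → recolour c v j w ≤ c w
    recolour≤ w with w ≟ v
    ... | yes refl = subst (_≤ c v) (sym (updateAt-updates v c)) (<⇒≤ j<cv)
    ... | no w≢v   = ≤-reflexive (updateAt-minimal w v c w≢v)

  lower : ∀ c → Acc (_<_ on ∑) c → IsProper X c → Extends c →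
          ∃[ c′ ] IsProper X c′ × IsGreedy X c′ × Extends c′
  lower c (acc rec) proper ext with defect? c
  ... | no none = c , proper , defect-free⇒greedy none , ext
  ... | yes (v , j , j<cv , blind) =
    lower (recolour c v j) (rec (recolour-decreases j<cv))
          (recolour-proper proper blind)
          (recolour-extends ext (defect-uncoloured ext j<cv blind))

  -- Uncoloured vertices start with pairwise distinct colours above every
  -- colour used by κ.
  bound : ℕ
  bound = suc (∑ (fromMaybe 0 ∘ κ))

  initial : Fin N → ℕ
  initial v = fromMaybe (bound + toℕ v) (κ v)

  κ<bound : ∀ {v i} → κ v ≡ just i → i < bound
  κ<bound {v} κv = s≤s (subst (_≤ _) (cong (fromMaybe 0) κv) (term≤∑ (fromMaybe 0 ∘ κ) v))

  initial-extends : Extends initial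
  initial-extends κv rewrite κv = refl

  initial-proper : IsProper X initial
  initial-proper v w e with κ v in κv | κ w in κw
  ... | just i  | just i′ = λ i≡i′ → proper e κv (subst (λ l → κ w ≡ just l) (sym i≡i′) κw)
  ... | just i  | nothing = λ i≡ → <⇒≱ (κ<bound κv) (≤-trans (m≤m+n bound (toℕ w)) (≤-reflexive (sym i≡)))
  ... | nothing | just i  = λ ≡i → <⇒≱ (κ<bound κw) (≤-trans (m≤m+n bound (toℕ v)) (≤-reflexive ≡i))
  ... | nothing | nothing = λ eq →
    ¬Adj-refl X (subst (Adj X v) (sym (toℕ-injective (+-cancelˡ-≡ bound _ _ eq))) e)

  extend : ∃[ c ] IsProper X c × IsGreedy X c × Extends c
  extend = lower initial (On.wellFounded ∑ <-wellFounded initial) initial-proper initial-extends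

partial-greedy⇒greedy-colouring-above : ∀ (X : Graph N) {κ} → IsPartialGreedy (Adj X) κ →
                        ∀ {v k} → κ v ≡ just k → ∃[ M ] k < M × HasGreedyColouring X M
partial-greedy⇒greedy-colouring-above X κ-greedy {v} κv with Extension.extend X κ-greedy
... | c , proper , greedy , ext with greedy-colouring-above X proper greedy v
...   | M , cv<M , greedyM = M , subst (_< M) (ext κv) cv<M , greedyM

module Product (G : Graph m) (H : Graph n) where

  _~_ : Fin m × Fin n → Fin m × Fin n → Set
  s ~ t = □-pairAdj G H s t ≡ true

  ~⇒□-adj : ∀ {a x b y} → (a , x) ~ (b , y) → (a ≡ b × Adj H x y) ⊎ (Adj G a b × x ≡ y)
  ~⇒□-adj {a} {x} {b} {y} e with T-∨ .to (T-≡ .from e)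
  ... | inj₁ t = let a≡b , xy = T-∧ .to t in inj₁ (toWitness {a? = a ≟ b} a≡b , T-≡ .to xy)
  ... | inj₂ t = let ab , x≡y = T-∧ .to t in inj₂ (T-≡ .to ab , toWitness {a? = x ≟ y} x≡y)

  ~-fibre : ∀ {a x y} → Adj H x y → (a , x) ~ (a , y)
  ~-fibre {a} e rewrite proj₂ (dec-yes (a ≟ a) refl) | e = refl

  ~-layer : ∀ {a b x} → Adj G a b → (a , x) ~ (b , x)
  ~-layer {x = x} e rewrite e | proj₂ (dec-yes (x ≟ x) refl) = ∨-zeroʳ _

  □-partial-greedy : ∀ {κ} → IsPartialGreedy _~_ κ → IsPartialGreedy (Adj (G □ H)) (κ ∘ remQuot n)
  □-partial-greedy {κ} κ-greedy = record
    { proper = proper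
    ; greedy = λ {p} κp j<i → lift-neighbour p (greedy κp j<i)
    }
    where
    open IsPartialGreedy κ-greedy
    lift-neighbour : ∀ {j} p → ∃[ t ] remQuot n p ~ t × κ t ≡ just j →
                     ∃[ w ] Adj (G □ H) p w × κ (remQuot n w) ≡ just j
    lift-neighbour {j} p ((b , y) , e , κt) =
      combine b y , subst (remQuot n p ~_) (sym decode) e , subst (λ t → κ t ≡ just j) (sym decode) κt
      where decode = remQuot-combine {k = n} b y

  module Layered {c : Fin n → ℕ} (c-proper : IsProper H c) (c-greedy : IsGreedy H c)
    {u : Fin m} {ψ : Fin n → Fin m} (ψ-proper : ProperColouring H m ψ) (ψ-adj : ∀ x → Adj G u (ψ x))
    where

    ψ≢u : ∀ x → ψ x ≢ u
    ψ≢u x ψx≡u = ¬Adj-refl G (subst (Adj G u) ψx≡u (ψ-adj x))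

    κ : Fin m × Fin n → Maybe ℕ
    κ (a , x) with a ≟ u | a ≟ ψ x
    ... | yes _ | _     = just (suc (c x))
    ... | no _  | yes _ = just 0
    ... | no _  | no _  = nothing

    data Layer : Fin m × Fin n → ℕ → Set where
      top    : ∀ x → Layer (u , x) (suc (c x))
      bottom : ∀ x → Layer (ψ x , x) 0

    κ⇒Layer : ∀ {s i} → κ s ≡ just i → Layer s i
    κ⇒Layer {a , x} κs with a ≟ u | a ≟ ψ x
    ... | yes refl | _        = subst (Layer _) (just-injective κs) (top x)
    ... | no _     | yes refl = subst (Layer _) (just-injective κs) (bottom x)

    Layer⇒κ : ∀ {s i} → Layer s i → κ s ≡ just i
    Layer⇒κ (top x) with u ≟ u
    ... | yes _  = refl
    ... | no u≢u = ⊥-elim (u≢u refl)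
    Layer⇒κ (bottom x) with ψ x ≟ u | ψ x ≟ ψ x
    ... | yes ψx≡u | _        = ⊥-elim (ψ≢u x ψx≡u)
    ... | no _     | yes _    = refl
    ... | no _     | no ψx≢ψx = ⊥-elim (ψx≢ψx refl)

    layers-proper : ∀ {s t i j} → s ~ t → Layer s i → Layer t j → i ≢ j
    layers-proper e (top x) (top y) eq with ~⇒□-adj e
    ... | inj₁ (_ , xy)   = c-proper x y xy (suc-injective eq)
    ... | inj₂ (uu , _)   = ¬Adj-refl G uu
    layers-proper e (bottom x) (bottom y) eq with ~⇒□-adj e
    ... | inj₁ (ψx≡ψy , xy) = ψ-proper x y xy ψx≡ψy
    ... | inj₂ (ψxψy , refl) = ¬Adj-refl G ψxψy

    layers-greedy : ∀ {s i} → Layer s i → ∀ {j} → j < i → ∃[ t ] s ~ t × κ t ≡ just j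
    layers-greedy (top x) {zero} _ = (ψ x , x) , ~-layer (ψ-adj x) , Layer⇒κ (bottom x)
    layers-greedy (top x) {suc j} j<cx with c-greedy x j (s≤s⁻¹ j<cx)
    ... | y , xy , refl = (u , y) , ~-fibre xy , Layer⇒κ (top y)

    κ-partial-greedy : IsPartialGreedy _~_ κ
    κ-partial-greedy = record
      { proper = λ e κs κt → layers-proper e (κ⇒Layer κs) (κ⇒Layer κt) refl
      ; greedy = λ κs → layers-greedy (κ⇒Layer κs)
      }

    □-greedy-colouring-above : ∀ x → ∃[ M ] suc (c x) < M × HasGreedyColouring (G □ H) M
    □-greedy-colouring-above x = partial-greedy⇒greedy-colouring-above (G □ H) (□-partial-greedy κ-partial-greedy)
      (trans (cong κ (remQuot-combine u x)) (Layer⇒κ (top x)))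

surjective⇒top-colour : ∀ (c : Fin (suc n) → Fin k) → (∀ i → ∃[ v ] c v ≡ i) →
                        ∃[ x ] k ≡ suc (toℕ (c x))
surjective⇒top-colour {k = zero}  c onto with () ← c Fin.zero
surjective⇒top-colour {k = suc k} c onto with onto (fromℕ k)
... | x , cx≡k = x , cong suc (trans (sym (toℕ-fromℕ k)) (cong toℕ (sym cx≡k)))

lemma32 : ∀ {m n} (G : Graph (suc m)) (H : Graph (suc n)) (χH ΓH ΓGH : ℕ) →
          IsChromaticNumber H χH → χH ≤ Δ G →
          IsGrundyNumber H ΓH → IsGrundyNumber (G □ H) ΓGH →
          ΓH + 1 ≤ ΓGH
lemma32 G H χH ΓH ΓGH ((φ , φ-proper) , _) χH≤ΔG ((c , c-onto , c-proper , c-greedy) , _) (_ , maximal) =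
  let u , ΔG≤deg       = Δ-attained G
      b , b-inj , b-adj = neighbourhood-injection G u (≤-trans χH≤ΔG ΔG≤deg)
      x , ΓH≡           = surjective⇒top-colour c c-onto
      M , top<M , greedy = Product.Layered.□-greedy-colouring-above G H
                            (toℕ-proper H c-proper) (toℕ-greedy H (c-onto , c-proper , c-greedy))
                            (λ x y xy → φ-proper x y xy ∘ b-inj) (b-adj ∘ φ) x
  in begin
       ΓH + 1 ≡⟨ +-comm ΓH 1 ⟩
       suc ΓH ≡⟨ cong suc ΓH≡ ⟩
       suc (suc (toℕ (c x))) ≤⟨ top<M ⟩
       M      ≤⟨ maximal M greedy ⟩
       ΓGH    ∎
  where open ≤-Reasoning
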